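{- Let $\Gamma$ be a finite sequence of implicational Horn formulas, $\Pi$ and $\Delta$ finite sequences of monotone formulas, and $q,r$ atoms. Then: (i) if the sequent $\Gamma,\Pi\Rightarrow\Delta$ is classically valid, then $\Gamma,\Pi\Rightarrow\bigvee\Delta$ is provable in $\mathbf{LJ}$; (ii) if the sequent $\Gamma\Rightarrow q\vee r$ is classically valid, then either $\Gamma\Rightarrow q$ or $\Gamma\Rightarrow r$ is classically valid.
   Context: Formulas are over $\{\top,\bot,\wedge,\vee,\to\}$; a formula is monotone if it contains no implication. An implicational Horn formula is either an atom or of the form $\bigwedge_{i=1}^k p_i\to r$ with $p_i,r$ atoms. A sequent $\Gamma\Rightarrow\Delta$ is valid if $\bigwedge\Gamma\to\bigvee\Delta$ is a classical tautology. $\mathbf{LJ}$ is Gentzen's intuitionistic sequent calculus (the classical calculus $\mathbf{LK}$ restricted to sequents with at most one formula on the right). -}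

module Defs where

open import Data.Nat using (ℕ)
open import Data.Bool using (Bool; true; false; _∧_; _∨_; not; T)
open import Data.List using (List; []; _∷_; _++_; [_])
open import Data.List.Relation.Unary.All using (All)
open import Data.List.Relation.Unary.Any using (Any)
open import Data.Maybe using (Maybe; just; nothing)

Atom : Set
Atom = ℕ

data Formula : Set where
  atom : Atom → Formula
  ⊤̇ ⊥̇ : Formula
  _∧̇_ _∨̇_ _⇒̇_ : Formula → Formula → Formula

infixr 6 _∧̇_
infixr 5 _∨̇_
infixr 4 _⇒̇_

data Monotone : Formula → Set where
  m-atom : ∀ p → Monotone (atom p)
  m-⊤ : Monotone ⊤̇
  m-⊥ : Monotone ⊥̇
  m-∧ : ∀ {A B} → Monotone A → Monotone B → Monotone (A ∧̇ B)
  m-∨ : ∀ {A B} → Monotone A → Monotone B → Monotone (A ∨̇ B)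

data ConjOfAtoms : Formula → Set where
  c-atom : ∀ p → ConjOfAtoms (atom p)
  c-∧ : ∀ {A B} → ConjOfAtoms A → ConjOfAtoms B → ConjOfAtoms (A ∧̇ B)

data Horn : Formula → Set where
  h-atom : ∀ p → Horn (atom p)
  h-imp : ∀ {A} → ConjOfAtoms A → ∀ r → Horn (A ⇒̇ atom r)

Valuation : Set
Valuation = Atom → Bool

⟦_⟧ : Formula → Valuation → Bool
⟦ atom p ⟧ v = v p
⟦ ⊤̇ ⟧ v = true
⟦ ⊥̇ ⟧ v = false
⟦ A ∧̇ B ⟧ v = ⟦ A ⟧ v ∧ ⟦ B ⟧ v
⟦ A ∨̇ B ⟧ v = ⟦ A ⟧ v ∨ ⟦ B ⟧ v
⟦ A ⇒̇ B ⟧ v = not (⟦ A ⟧ v) ∨ ⟦ B ⟧ v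

Valid : List Formula → List Formula → Set
Valid Γ Δ = ∀ (v : Valuation) → All (λ A → T (⟦ A ⟧ v)) Γ → Any (λ B → T (⟦ B ⟧ v)) Δ

⋁ : List Formula → Formula
⋁ [] = ⊥̇
⋁ (A ∷ []) = A
⋁ (A ∷ B ∷ Δ) = A ∨̇ ⋁ (B ∷ Δ)

-- Gentzen's LJ: sequents Γ ⊢ C with at most one formula (Maybe) on the right.
infix 2 _⊢_
data _⊢_ : List Formula → Maybe Formula → Set where
  ax   : ∀ {A} → [ A ] ⊢ just A
  ⊥L   : ∀ {C} → [ ⊥̇ ] ⊢ C
  ⊤R   : [] ⊢ just ⊤̇
  wL   : ∀ {Γ A C} → Γ ⊢ C → A ∷ Γ ⊢ C
  wR   : ∀ {Γ A} → Γ ⊢ nothing → Γ ⊢ just A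
  cL   : ∀ {Γ A C} → A ∷ A ∷ Γ ⊢ C → A ∷ Γ ⊢ C
  xL   : ∀ Γ {Σ A B C} → Γ ++ A ∷ B ∷ Σ ⊢ C → Γ ++ B ∷ A ∷ Σ ⊢ C
  cut  : ∀ {Γ Σ A C} → Γ ⊢ just A → A ∷ Σ ⊢ C → Γ ++ Σ ⊢ C
  ∧L₁  : ∀ {Γ A B C} → A ∷ Γ ⊢ C → (A ∧̇ B) ∷ Γ ⊢ C
  ∧L₂  : ∀ {Γ A B C} → B ∷ Γ ⊢ C → (A ∧̇ B) ∷ Γ ⊢ C
  ∧R   : ∀ {Γ A B} → Γ ⊢ just A → Γ ⊢ just B → Γ ⊢ just (A ∧̇ B)
  ∨L   : ∀ {Γ A B C} → A ∷ Γ ⊢ C → B ∷ Γ ⊢ C → (A ∨̇ B) ∷ Γ ⊢ C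
  ∨R₁  : ∀ {Γ A B} → Γ ⊢ just A → Γ ⊢ just (A ∨̇ B)
  ∨R₂  : ∀ {Γ A B} → Γ ⊢ just B → Γ ⊢ just (A ∨̇ B)
  ⇒L   : ∀ {Γ Σ A B C} → Γ ⊢ just A → B ∷ Σ ⊢ C → (A ⇒̇ B) ∷ (Γ ++ Σ) ⊢ C
  ⇒R   : ∀ {Γ A B} → A ∷ Γ ⊢ just B → Γ ⊢ just (A ⇒̇ B)

{-# OPTIONS --safe #-}
module Submission where

-- Forward chaining computes, for a list Θ of implicational Horn formulas, a model of Θ in
-- which every true atom is LJ-derivable from Θ. A monotone formula true in that model is
-- then derivable as well, by the right rules. So if Θ ⇒ Δ is valid with Δ monotone, some
-- member of Δ is true in the model, hence derivable, and ⋁Δ follows. Monotone antecedents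
-- are reduced to this case by the left rules for ∧ and ∨, the atoms they leave behind
-- being Horn formulas themselves. For (ii), the model makes q or r true; that atom is
-- derivable from Γ, hence, by soundness of LJ, a classical consequence of Γ.

open import Defs
open import Data.Bool using (true; false; _∨_; not; T)
open import Data.Bool.Properties using (T-∧; T-∨; T?)
open import Data.Empty using (⊥-elim)
open import Data.List using (List; []; _∷_; _++_; [_])
open import Data.List.Membership.Propositional using (_∈_; find)
open import Data.List.Membership.Propositional.Properties using (∈-∃++; ∈-++⁺ʳ)
open import Data.List.Properties using (++-assoc; ++-identityʳ)
open import Data.List.Relation.Binary.Permutation.Propositional using (_↭_; refl; prep; swap; trans; ↭-sym)
open import Data.List.Relation.Binary.Permutation.Propositional.Properties using (All-resp-↭; shift; ++-comm; ++⁺ˡ)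
open import Data.List.Relation.Binary.Subset.Propositional using (_⊆_)
open import Data.List.Relation.Binary.Subset.Propositional.Properties using (⊆-reflexive; ∈-∷⁺ʳ; xs⊆xs++ys)
open import Data.List.Relation.Unary.All using (All; []; _∷_; lookup)
import Data.List.Relation.Unary.All.Properties as All
open import Data.List.Relation.Unary.Any using (here; there)
open import Data.List.Relation.Unary.Any.Properties using (singleton⁻)
open import Data.Maybe using (Maybe; just; fromMaybe)
open import Data.Nat using (_≡ᵇ_)
open import Data.Nat.Properties using (≡ᵇ⇒≡; ≡⇒≡ᵇ)
open import Data.Product using (Σ-syntax; _×_; _,_; proj₁; proj₂)
open import Data.Sum using (_⊎_; inj₁; inj₂)
import Data.Sum as Sum
open import Function using (_∘_; id; const; _$_; _⇔_; mk⇔; Equivalence)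
open import Relation.Binary.PropositionalEquality using (refl; sym; subst)
open import Relation.Nullary using (¬_; yes; no)

open Equivalence using (to; from)

private
  variable
    Γ Γ' Θ Π Δ : List Formula
    A B H : Formula
    C : Maybe Formula

⊢-resp-↭ : Γ ↭ Γ' → Γ ⊢ C → Γ' ⊢ C
⊢-resp-↭ = exchange-after []
  where
  reassoc : ∀ Φ Ψ {Σ C} → (Φ ++ Ψ) ++ Σ ⊢ C → Φ ++ Ψ ++ Σ ⊢ C
  reassoc Φ Ψ {Σ} {C} = subst (_⊢ C) (++-assoc Φ Ψ Σ)

  unassoc : ∀ Φ Ψ {Σ C} → Φ ++ Ψ ++ Σ ⊢ C → (Φ ++ Ψ) ++ Σ ⊢ C
  unassoc Φ Ψ {Σ} {C} = subst (_⊢ C) (sym (++-assoc Φ Ψ Σ))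

  exchange-after : ∀ Φ → Γ ↭ Γ' → Φ ++ Γ ⊢ C → Φ ++ Γ' ⊢ C
  exchange-after Φ refl d = d
  exchange-after Φ (prep x p) d =
    reassoc Φ [ x ] (exchange-after (Φ ++ [ x ]) p (unassoc Φ [ x ] d))
  exchange-after Φ (swap x y p) d =
    reassoc Φ (y ∷ x ∷ []) (exchange-after (Φ ++ y ∷ x ∷ []) p (unassoc Φ (y ∷ x ∷ []) (xL Φ d)))
  exchange-after Φ (trans p q) d = exchange-after Φ q (exchange-after Φ p d)

weakenˡ : ∀ Ξ → Γ ⊢ C → Ξ ++ Γ ⊢ C
weakenˡ []      d = d
weakenˡ (_ ∷ Ξ) d = wL (weakenˡ Ξ d)

contract : A ∈ Γ → A ∷ Γ ⊢ C → Γ ⊢ C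
contract {A} A∈Γ d with Γ₁ , Γ₂ , refl ← ∈-∃++ A∈Γ =
  ⊢-resp-↭ (↭-sym (shift A Γ₁ Γ₂)) (cL (⊢-resp-↭ (prep A (shift A Γ₁ Γ₂)) d))

contractˡ : ∀ Ξ → Ξ ⊆ Γ → Ξ ++ Γ ⊢ C → Γ ⊢ C
contractˡ []      _      d = d
contractˡ (A ∷ Ξ) A∷Ξ⊆Γ d =
  contractˡ Ξ (A∷Ξ⊆Γ ∘ there) (contract (∈-++⁺ʳ Ξ (A∷Ξ⊆Γ (here refl))) d)

⊢-resp-⊆ : Γ ⊆ Γ' → Γ ⊢ C → Γ' ⊢ C
⊢-resp-⊆ {Γ} {Γ'} Γ⊆Γ' d = contractˡ Γ Γ⊆Γ' (⊢-resp-↭ (++-comm Γ' Γ) (weakenˡ Γ' d))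

ax-∈ : A ∈ Γ → Γ ⊢ just A
ax-∈ A∈Γ = ⊢-resp-⊆ (∈-∷⁺ʳ A∈Γ (λ ())) ax

mp-∈ : (A ⇒̇ B) ∈ Γ → Γ ⊢ just A → Γ ⊢ just B
mp-∈ {Γ = Γ} A⇒B∈Γ d = ⊢-resp-⊆ (∈-∷⁺ʳ A⇒B∈Γ (⊆-reflexive (++-identityʳ Γ))) (⇒L d ax)

∧L : A ∷ B ∷ Γ ⊢ C → A ∧̇ B ∷ Γ ⊢ C
∧L d = cL (∧L₂ (xL [] (∧L₁ d)))

⋁-intro : B ∈ Δ → Γ ⊢ just B → Γ ⊢ just (⋁ Δ)
⋁-intro {Δ = _ ∷ []}    (here refl)  d = d
⋁-intro {Δ = _ ∷ _ ∷ _} (here refl)  d = ∨R₁ d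
⋁-intro {Δ = _ ∷ _ ∷ _} (there B∈Δ) d = ∨R₂ (⋁-intro B∈Δ d)

infix 4 _⊨_

_⊨_ : Valuation → List Formula → Set
v ⊨ Γ = All (λ A → T (⟦ A ⟧ v)) Γ

Valid-resp-↭ : Γ ↭ Γ' → Valid Γ Δ → Valid Γ' Δ
Valid-resp-↭ Γ↭Γ' valid v v⊨Γ' = valid v (All-resp-↭ (↭-sym Γ↭Γ') v⊨Γ')

T-⇒̇ : ∀ a {b} → T (not a ∨ b) ⇔ (T a → T b)
T-⇒̇ true  = mk⇔ const (_$ _)
T-⇒̇ false = mk⇔ (λ _ ()) (const _)

T-⇒̇-antecedent : ∀ a {b} → ¬ T (not a ∨ b) → T a
T-⇒̇-antecedent true  _   = _
T-⇒̇-antecedent false a⇒b = a⇒b _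

soundness : Γ ⊢ C → ∀ v → v ⊨ Γ → T (⟦ fromMaybe ⊥̇ C ⟧ v)
soundness ax          v (a ∷ [])   = a
soundness ⊥L          v (() ∷ [])
soundness ⊤R          v []         = _
soundness (wL d)      v (_ ∷ v⊨Γ)  = soundness d v v⊨Γ
soundness (wR d)      v v⊨Γ        = ⊥-elim (soundness d v v⊨Γ)
soundness (cL d)      v (a ∷ v⊨Γ)  = soundness d v (a ∷ a ∷ v⊨Γ)
soundness (xL Γ {A = A} {B} d) v v⊨Γ =
  soundness d v (All-resp-↭ (++⁺ˡ Γ (swap B A refl)) v⊨Γ)
soundness (cut {Γ} d e) v v⊨Γ =
  soundness e v (soundness d v (All.++⁻ˡ Γ v⊨Γ) ∷ All.++⁻ʳ Γ v⊨Γ)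
soundness (∧L₁ d)     v (ab ∷ v⊨Γ) = soundness d v (proj₁ (to T-∧ ab) ∷ v⊨Γ)
soundness (∧L₂ d)     v (ab ∷ v⊨Γ) = soundness d v (proj₂ (to T-∧ ab) ∷ v⊨Γ)
soundness (∧R d e)    v v⊨Γ        = from T-∧ (soundness d v v⊨Γ , soundness e v v⊨Γ)
soundness (∨L d e)    v (ab ∷ v⊨Γ) with to T-∨ ab
... | inj₁ a = soundness d v (a ∷ v⊨Γ)
... | inj₂ b = soundness e v (b ∷ v⊨Γ)
soundness (∨R₁ d)     v v⊨Γ        = from T-∨ (inj₁ (soundness d v v⊨Γ))
soundness (∨R₂ d)     v v⊨Γ        = from T-∨ (inj₂ (soundness d v v⊨Γ))
soundness (⇒L {Γ} {A = A} d e) v (a⇒b ∷ v⊨Γ) =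
  soundness e v (to (T-⇒̇ (⟦ A ⟧ v)) a⇒b (soundness d v (All.++⁻ˡ Γ v⊨Γ)) ∷ All.++⁻ʳ Γ v⊨Γ)
soundness (⇒R {A = A} d) v v⊨Γ     = from (T-⇒̇ (⟦ A ⟧ v)) (λ a → soundness d v (a ∷ v⊨Γ))

valid-singleton : Γ ⊢ just A → Valid Γ [ A ]
valid-singleton d v v⊨Γ = here (soundness d v v⊨Γ)

infix 4 _⊑_

_⊑_ : Valuation → Valuation → Set
v ⊑ w = ∀ p → T (v p) → T (w p)

⊑-refl : ∀ {v} → v ⊑ v
⊑-refl _ = id

⊑-trans : ∀ {u v w} → u ⊑ v → v ⊑ w → u ⊑ w
⊑-trans u⊑v v⊑w p = v⊑w p ∘ u⊑v p

assert : Atom → Valuation → Valuation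
assert p v q = (p ≡ᵇ q) ∨ v q

⊑-assert : ∀ p {v} → v ⊑ assert p v
⊑-assert p q = from T-∨ ∘ inj₂

assert-true : ∀ p {v} → T (assert p v p)
assert-true p = from T-∨ (inj₁ (≡⇒≡ᵇ p p refl))

head : Horn H → Atom
head (h-atom p)  = p
head (h-imp _ r) = r

head-true⇒true : ∀ {v} (h : Horn H) → T (v (head h)) → T (⟦ H ⟧ v)
head-true⇒true         (h-atom _)      t = t
head-true⇒true {v = v} (h-imp {A} _ _) t = from (T-⇒̇ (⟦ A ⟧ v)) (const t)

conj-monotone : ConjOfAtoms A → Monotone A
conj-monotone (c-atom p) = m-atom p
conj-monotone (c-∧ a b)  = m-∧ (conj-monotone a) (conj-monotone b)

Grounded : List Formula → Valuation → Set
Grounded Θ v = ∀ p → T (v p) → Θ ⊢ just (atom p)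

module _ {v : Valuation} (grounded : Grounded Θ v) where

  monotone-derivable : Monotone A → T (⟦ A ⟧ v) → Θ ⊢ just A
  monotone-derivable (m-atom p) t = grounded p t
  monotone-derivable m-⊤        _ = ⊢-resp-⊆ (λ ()) ⊤R
  monotone-derivable (m-∧ a b)  t with to T-∧ t
  ... | tA , tB = ∧R (monotone-derivable a tA) (monotone-derivable b tB)
  monotone-derivable (m-∨ a b)  t with to T-∨ t
  ... | inj₁ tA = ∨R₁ (monotone-derivable a tA)
  ... | inj₂ tB = ∨R₂ (monotone-derivable b tB)

  head-derivable : H ∈ Θ → (h : Horn H) → ¬ T (⟦ H ⟧ v) → Θ ⊢ just (atom (head h))
  head-derivable H∈Θ (h-atom _)      _ = ax-∈ H∈Θ
  head-derivable H∈Θ (h-imp {A} c _) v⊭H =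
    mp-∈ H∈Θ (monotone-derivable (conj-monotone c) (T-⇒̇-antecedent (⟦ A ⟧ v) v⊭H))

  grounded-assert : ∀ p → Θ ⊢ just (atom p) → Grounded Θ (assert p v)
  grounded-assert p d q t with to T-∨ t
  ... | inj₁ p≡ᵇq with refl ← ≡ᵇ⇒≡ p q p≡ᵇq = d
  ... | inj₂ vq = grounded q vq

module _ (hornΘ : All Horn Θ) where

  -- Once H's head has been asserted, H stays true in every larger valuation, so saturating R
  -- a second time cannot falsify it again.
  saturate : ∀ R → R ⊆ Θ → ∀ v → Grounded Θ v → Σ[ w ∈ Valuation ] v ⊑ w × Grounded Θ w × w ⊨ R
  saturate []      _     v grounded = v , ⊑-refl , grounded , []
  saturate (H ∷ R) H∷R⊆Θ v grounded
    with w , v⊑w , groundedʷ , w⊨R ← saturate R (H∷R⊆Θ ∘ there) v grounded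
    with T? (⟦ H ⟧ w)
  ... | yes w⊨H = w , v⊑w , groundedʷ , w⊨H ∷ w⊨R
  ... | no  w⊭H
    with H∈Θ ← H∷R⊆Θ (here refl)
    with h ← lookup hornΘ H∈Θ
    with u , w⁺⊑u , groundedᵘ , u⊨R ←
           saturate R (H∷R⊆Θ ∘ there) (assert (head h) w)
             (grounded-assert groundedʷ (head h) (head-derivable groundedʷ H∈Θ h w⊭H))
    = u , ⊑-trans v⊑w (⊑-trans (⊑-assert (head h)) w⁺⊑u) , groundedᵘ
        , head-true⇒true h (w⁺⊑u (head h) (assert-true (head h) {w})) ∷ u⊨R

  grounded-model : Σ[ v ∈ Valuation ] Grounded Θ v × v ⊨ Θ
  grounded-model with v , _ , grounded , v⊨Θ ← saturate Θ id (const false) (λ _ ()) =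
    v , grounded , v⊨Θ

  horn-monotone-complete : All Monotone Δ → Valid Θ Δ → Θ ⊢ just (⋁ Δ)
  horn-monotone-complete monoΔ valid
    with v , grounded , v⊨Θ ← grounded-model
    with B , B∈Δ , v⊨B ← find (valid v v⊨Θ) =
    ⋁-intro B∈Δ (monotone-derivable grounded (lookup monoΔ B∈Δ) v⊨B)

  horn-disjunction-property : ∀ q r → Valid Θ [ atom q ∨̇ atom r ] → Valid Θ [ atom q ] ⊎ Valid Θ [ atom r ]
  horn-disjunction-property q r valid with v , grounded , v⊨Θ ← grounded-model =
    Sum.map (valid-singleton ∘ grounded q) (valid-singleton ∘ grounded r)
            (to T-∨ (singleton⁻ (valid v v⊨Θ)))

HornComplete : List Formula → List Formula → Set
HornComplete Π Δ = ∀ Θ → All Horn Θ → Valid (Π ++ Θ) Δ → Π ++ Θ ⊢ just (⋁ Δ)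

horn-complete-∷ : Monotone A → HornComplete Π Δ → HornComplete (A ∷ Π) Δ
horn-complete-∷ {Π = Π} (m-atom p) complete Θ hornΘ valid =
  ⊢-resp-↭ (shift (atom p) Π Θ)
    (complete (atom p ∷ Θ) (h-atom p ∷ hornΘ) (Valid-resp-↭ (↭-sym (shift (atom p) Π Θ)) valid))
horn-complete-∷ m-⊤ complete Θ hornΘ valid =
  wL (complete Θ hornΘ (λ v v⊨Γ → valid v (_ ∷ v⊨Γ)))
horn-complete-∷ m-⊥ complete Θ hornΘ valid = ⊢-resp-⊆ (xs⊆xs++ys [ ⊥̇ ] _) ⊥L
horn-complete-∷ (m-∧ a b) complete Θ hornΘ valid =
  ∧L (horn-complete-∷ a (horn-complete-∷ b complete) Θ hornΘ
        (λ { v (tA ∷ tB ∷ v⊨Γ) → valid v (from T-∧ (tA , tB) ∷ v⊨Γ) }))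
horn-complete-∷ (m-∨ a b) complete Θ hornΘ valid =
  ∨L (horn-complete-∷ a complete Θ hornΘ (λ { v (tA ∷ v⊨Γ) → valid v (from T-∨ (inj₁ tA) ∷ v⊨Γ) }))
     (horn-complete-∷ b complete Θ hornΘ (λ { v (tB ∷ v⊨Γ) → valid v (from T-∨ (inj₂ tB) ∷ v⊨Γ) }))

horn-complete : All Monotone Π → All Monotone Δ → HornComplete Π Δ
horn-complete []              monoΔ Θ hornΘ = horn-monotone-complete hornΘ monoΔ
horn-complete (monoA ∷ monoΠ) monoΔ         = horn-complete-∷ monoA (horn-complete monoΠ monoΔ)

lemma7p5 : (Γ Π Δ : List Formula) → All Horn Γ → All Monotone Π → All Monotone Δ → (q r : Atom)
    → (Valid (Γ ++ Π) Δ → Γ ++ Π ⊢ just (⋁ Δ))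
      × (Valid Γ [ atom q ∨̇ atom r ] → Valid Γ [ atom q ] ⊎ Valid Γ [ atom r ])
lemma7p5 Γ Π Δ hornΓ monoΠ monoΔ q r =
    (λ valid → ⊢-resp-↭ (++-comm Π Γ)
                 (horn-complete monoΠ monoΔ Γ hornΓ (Valid-resp-↭ (++-comm Γ Π) valid)))
  , horn-disjunction-property hornΓ q r
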